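{- For every integer $k>1$, $R_{2k}(X;1,1)=R_{2k}(X)$.
   Context: For a positive integer $K$ and the trivial Dirichlet character $1$ (modulo $1$), the generalized Ramanujan polynomial is \[ R_K(X;1,1)=\sum_{s=0}^{K}\frac{B_{s,1}}{s!}\frac{B_{K-s,1}}{(K-s)!}(X-1)^{K-s-1}\big(1-X^{s-1}\big), \] where the $B_{n,1}$ are defined by $\sum_{n\ge0}B_{n,1}\frac{x^n}{n!}=\frac{xe^{x}}{e^{x}-1}$ (so $B_{n,1}=B_n$ for $n\ne1$ and $B_{1,1}=1/2$). The Ramanujan polynomial is $R_K(X)=\sum_{s=0}^{K}\frac{B_s}{s!}\frac{B_{K-s}}{(K-s)!}X^{s-1}$, where $B_n$ are the Bernoulli numbers, $\frac{x}{e^x-1}=\sum_{n\ge0}B_n\frac{x^n}{n!}$. Both are Laurent polynomials in $X$. -}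

module Defs where

open import Data.Nat as ℕ using (ℕ; zero; suc; _!)
open import Data.Nat.Combinatorics using (_C_)
open import Data.Integer as ℤ using (ℤ; +_; -[1+_])
open import Data.Rational as ℚ using (ℚ; 0ℚ; 1ℚ; _+_; _*_; _-_; -_; _/_; 1/_; NonZero; ≢-nonZero)
open import Data.List using (List; []; _∷_; _++_; foldr; map; zipWith; upTo)
open import Data.Nat.Properties using (_!≢0)
open import Relation.Binary.PropositionalEquality using (_≢_)

sumℚ : List ℚ → ℚ
sumℚ = foldr _+_ 0ℚ

ℕ→ℚ : ℕ → ℚ
ℕ→ℚ n = (+ n) / 1

_^ℕ_ : ℚ → ℕ → ℚ
x ^ℕ zero  = 1ℚ
x ^ℕ suc n = x * (x ^ℕ n)

powℤ : (x : ℚ) → x ≢ 0ℚ → ℤ → ℚ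
powℤ x x≢0 (+ n)    = x ^ℕ n
powℤ x x≢0 -[1+ n ] = (1/_ x {{≢-nonZero x≢0}}) ^ℕ suc n

-- Bernoulli numbers (x/(e^x-1) convention, B₁ = -1/2), via the standard
-- recurrence  Σ_{j=0}^{n} C(n+1,j) B_j = 0 (n ≥ 1), B₀ = 1,
-- which is equivalent to the generating function x/(e^x - 1).
-- bernNext n l computes B_n from l = [B₀, …, B_{n-1}].
bernNext : ℕ → List ℚ → ℚ
bernNext zero    l = 1ℚ
bernNext (suc m) l =
  - ((+ 1 / suc (suc m)) *
     sumℚ (zipWith (λ j b → ℕ→ℚ (suc (suc m) C j) * b) (upTo (suc m)) l))

bernList : ℕ → List ℚ
bernList zero    = []
bernList (suc n) = bernList n ++ (bernNext n (bernList n) ∷ [])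

bernoulli : ℕ → ℚ
bernoulli n = bernNext n (bernList n)

-- B_{n,1}: generating function x e^x/(e^x-1); equals B_n except B_{1,1} = 1/2
bernoulli1 : ℕ → ℚ
bernoulli1 1 = + 1 / 2
bernoulli1 n = bernoulli n

bf : (ℕ → ℚ) → ℕ → ℚ
bf b n = b n * (_/_ (+ 1) (n !) {{n !≢0}})

-- Evaluation at a rational x ∉ {0,1} of the generalized Ramanujan polynomial
--   R_K(X;1,1) = Σ_{s=0}^{K} (B_{s,1}/s!) (B_{K-s,1}/(K-s)!) (X-1)^{K-s-1} (1 - X^{s-1})
ramanujanGen : ℕ → (x : ℚ) → x ≢ 0ℚ → x - 1ℚ ≢ 0ℚ → ℚ
ramanujanGen K x x≢0 x≢1 =
  sumℚ (map (λ s → bf bernoulli1 s * bf bernoulli1 (K ℕ.∸ s)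
                    * powℤ (x - 1ℚ) x≢1 ((+ K) ℤ.- (+ s) ℤ.- (+ 1))
                    * (1ℚ - powℤ x x≢0 ((+ s) ℤ.- (+ 1))))
            (upTo (suc K)))

-- Evaluation at a rational x ≠ 0 of the Ramanujan polynomial
--   R_K(X) = Σ_{s=0}^{K} (B_s/s!) (B_{K-s}/(K-s)!) X^{s-1}
ramanujan : ℕ → (x : ℚ) → x ≢ 0ℚ → ℚ
ramanujan K x x≢0 =
  sumℚ (map (λ s → bf bernoulli s * bf bernoulli (K ℕ.∸ s)
                    * powℤ x x≢0 ((+ s) ℤ.- (+ 1)))
            (upTo (suc K)))

{-# OPTIONS --safe #-}
-- With B(t) = t/(e^t - 1) = Σ Bₙ tⁿ/n! and F_a(t) = t/(e^{a t} - 1) = Σ Bₙ aⁿ⁻¹ tⁿ/n!, the values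
-- R_K(x) and R_K(x;1,1) are the coefficients of t^K in F_x B and in (B - F_x)(F_{x-1} + t), since
-- Σ B_{n,1} aⁿ⁻¹ tⁿ/n! = F_a + t.  Clearing denominators, e^{x t} = e^t e^{(x-1) t} becomes
-- B F_{x-1} = (B + F_{x-1} + t) F_x, so (B - F_x)(F_{x-1} + t) = F_x B + t B and
-- R_K(x;1,1) = R_K(x) + B_{K-1}/(K-1)!.  In the same way e^t e^{-t} = 1 becomes F_1 + F_{-1} = -t,
-- i.e. B(t) + t/2 is even, so B_{K-1} = 0 for even K ≥ 4.
-- Power series are sequences ℕ → ℚ under the Cauchy product; e^{a t} e^{b t} = e^{(a+b) t} holds
-- because both sides solve θu = (a + b) t u, for θ = t d/dt, with the same constant term.
module Submission where

module RamanujanPolynomials where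

  open import Level using (0ℓ)
  open import Data.Nat as ℕ using (ℕ; zero; suc; _!; _≤_; _<_; s≤s; z≤n; _∸_)
  import Data.Nat.Properties as ℕ
  open import Data.Nat.Properties using (_!≢0)
  open import Data.Nat.Combinatorics using (_C_; nCk≡nC[n∸k]; nC1≡n; nCn≡1; k![n∸k]!∣n!)
  open import Data.Nat.Combinatorics.Specification using (nCk≡n!/k![n-k]!)
  open import Data.Nat.DivMod using (m/n*n≡m)
  import Data.Nat.Tactic.RingSolver as ℕ-Solver
  import Data.Integer.Tactic.RingSolver as ℤ-Solver
  open import Data.Integer as ℤ using (+_)
  import Data.Integer.Properties as ℤ
  open import Data.Rational as ℚ using (ℚ; 0ℚ; 1ℚ; _+_; _*_; _-_; -_; _/_; 1/_; ≢-nonZero)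
  import Data.Rational.Properties as ℚ
  open import Data.Rational.Unnormalised using (mkℚᵘ; *≡*)
  import Data.Rational.Unnormalised.Properties as ℚᵘ
  open import Data.Maybe.Base as Maybe using (Maybe)
  open import Data.List using (_∷_; _∷ʳ_; applyUpTo; upTo; zipWith)
  import Data.List.Properties as List
  open import Relation.Nullary.Decidable using (dec⇒maybe)
  open import Data.Product using (_,_)
  open import Relation.Binary.PropositionalEquality
    using (_≡_; _≢_; refl; sym; trans; cong; cong₂; module ≡-Reasoning)
  open import Algebra.Bundles using (CommutativeRing)
  import Algebra.Construct.Pointwise as Pointwise
  open import Algebra.Solver.Ring.AlmostCommutativeRing using (fromCommutativeRing; _-Raw-AlmostCommutative⟶_)
  import Algebra.Solver.Ring as RingSolver
  import Relation.Binary.Reasoning.Setoid as SetoidReasoning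
  import Tactic.RingSolver.Core.AlmostCommutativeRing as Tactic
  open import Tactic.RingSolver using (solve-∀)

  open import Defs

  ℚ-ring : Tactic.AlmostCommutativeRing 0ℓ 0ℓ
  ℚ-ring = Tactic.fromCommutativeRing ℚ.+-*-commutativeRing (λ p → dec⇒maybe (0ℚ ℚ.≟ p))

  *-cancelˡ-≢0 : ∀ {p q r} → p ≢ 0ℚ → p * q ≡ p * r → q ≡ r
  *-cancelˡ-≢0 {p} {q} {r} p≢0 pq≡pr =
    trans (sym (inverse-cancel q)) (trans (cong ((1/ p) *_) pq≡pr) (inverse-cancel r))
    where
    instance _ = ≢-nonZero p≢0
    inverse-cancel : ∀ s → (1/ p) * (p * s) ≡ s
    inverse-cancel s = trans (sym (ℚ.*-assoc (1/ p) p s))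
      (trans (cong (_* s) (ℚ.*-inverseˡ p)) (ℚ.*-identityˡ s))

  /-cross : ∀ a b m n .{{_ : ℕ.NonZero m}} .{{_ : ℕ.NonZero n}} →
            a ℕ.* n ≡ b ℕ.* m → + a / m ≡ + b / n
  /-cross a b (suc m) (suc n) eq = ℚ.fromℚᵘ-cong {mkℚᵘ (+ a) m} {mkℚᵘ (+ b) n}
    (*≡* (trans (sym (ℤ.pos-* a (suc n))) (trans (cong +_ eq) (ℤ.pos-* b (suc m)))))

  /-*-/ : ∀ a b m n .{{_ : ℕ.NonZero m}} .{{_ : ℕ.NonZero n}} →
          (+ a / m) * (+ b / n) ≡ (+ (a ℕ.* b) / (m ℕ.* n)) {{ℕ.m*n≢0 m n}}
  /-*-/ a b (suc m) (suc n) = trans (sym (ℚ.fromℚᵘ-toℚᵘ _))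
    (ℚ.fromℚᵘ-cong {y = mkℚᵘ (+ (a ℕ.* b)) (n ℕ.+ m ℕ.* suc n)}
    (ℚᵘ.≃-trans (ℚ.toℚᵘ-homo-* (+ a / suc m) (+ b / suc n))
      (ℚᵘ.≃-trans (ℚᵘ.*-cong (ℚ.toℚᵘ-fromℚᵘ (mkℚᵘ (+ a) m)) (ℚ.toℚᵘ-fromℚᵘ (mkℚᵘ (+ b) n)))
        (*≡* (cong (ℤ._* + suc (n ℕ.+ m ℕ.* suc n)) (sym (ℤ.pos-* a b)))))))

  ℕ→ℚ-suc : ∀ n → ℕ→ℚ (suc n) ≡ ℕ→ℚ n + 1ℚ
  ℕ→ℚ-suc n = sym (trans (sym (ℚ.fromℚᵘ-toℚᵘ _)) (ℚ.fromℚᵘ-cong {y = mkℚᵘ (+ suc n) 0}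
    (ℚᵘ.≃-trans (ℚ.toℚᵘ-homo-+ (ℕ→ℚ n) 1ℚ)
      (ℚᵘ.≃-trans (ℚᵘ.+-congˡ _ (ℚ.toℚᵘ-fromℚᵘ (mkℚᵘ (+ n) 0)))
        (*≡* (numerator (+ n)))))))
    where
    numerator : ∀ i → (i ℤ.* + 1 ℤ.+ + 1 ℤ.* + 1) ℤ.* + 1 ≡ (+ 1 ℤ.+ i) ℤ.* + 1
    numerator = solve-∀ ℤ-Solver.ring

  1/[1+n]*[1+n]≡1 : ∀ n → (+ 1 / suc n) * ℕ→ℚ (suc n) ≡ 1ℚ
  1/[1+n]*[1+n]≡1 n = trans (/-*-/ 1 (suc n) (suc n) 1) (/-cross (1 ℕ.* suc n) 1 (suc n ℕ.* 1) 1 (cross n))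
    where
    cross : ∀ n → 1 ℕ.* suc n ℕ.* 1 ≡ 1 ℕ.* (suc n ℕ.* 1)
    cross = ℕ-Solver.solve-∀

  ℕ→ℚ-suc≢0 : ∀ n → ℕ→ℚ (suc n) ≢ 0ℚ
  ℕ→ℚ-suc≢0 n eq with trans (sym (1/[1+n]*[1+n]≡1 n)) (trans (cong ((+ 1 / suc n) *_) eq) (ℚ.*-zeroʳ (+ 1 / suc n)))
  ... | ()

  invFact : ℕ → ℚ
  invFact n = (+ 1 / n !) {{n !≢0}}

  ℕ→ℚ-suc*invFact : ∀ n → ℕ→ℚ (suc n) * invFact (suc n) ≡ invFact n
  ℕ→ℚ-suc*invFact n = trans (/-*-/ (suc n) 1 1 (suc n !)) (/-cross (suc n ℕ.* 1) 1 (1 ℕ.* suc n !) (n !) (cross n (n !)))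
    where
    instance
      _ = n !≢0
      _ = suc n !≢0
      _ = ℕ.m*n≢0 1 (suc n !)
    cross : ∀ n f → suc n ℕ.* 1 ℕ.* f ≡ 1 ℕ.* (1 ℕ.* (f ℕ.+ n ℕ.* f))
    cross = ℕ-Solver.solve-∀

  choose*factorials : ∀ {n j} → j ≤ n → (n C j) ℕ.* (j ! ℕ.* (n ∸ j) !) ≡ n !
  choose*factorials {n} {j} j≤n = trans (cong (ℕ._* (j ! ℕ.* (n ∸ j) !)) (nCk≡n!/k![n-k]! j≤n))
    (m/n*n≡m {{ℕ.m*n≢0 (j !) ((n ∸ j) !) {{j !≢0}} {{(n ∸ j) !≢0}}}} (k![n∸k]!∣n! j≤n))

  choose*invFact : ∀ {n j} → j ≤ n → ℕ→ℚ (n C j) * invFact n ≡ invFact j * invFact (n ∸ j)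
  choose*invFact {n} {j} j≤n = begin
    ℕ→ℚ (n C j) * invFact n                   ≡⟨ /-*-/ (n C j) 1 1 (n !) ⟩
    + ((n C j) ℕ.* 1) / (1 ℕ.* n !)           ≡⟨ /-cross ((n C j) ℕ.* 1) (1 ℕ.* 1) (1 ℕ.* n !) (j ! ℕ.* (n ∸ j) !) cross ⟩
    + (1 ℕ.* 1) / (j ! ℕ.* (n ∸ j) !)         ≡⟨ /-*-/ 1 1 (j !) ((n ∸ j) !) ⟨
    invFact j * invFact (n ∸ j)               ∎
    where
    open ≡-Reasoning
    instance
      _ = n !≢0
      _ = j !≢0
      _ = (n ∸ j) !≢0
      _ = ℕ.m*n≢0 1 (n !)
      _ = ℕ.m*n≢0 (j !) ((n ∸ j) !)
    one*one*one* : ∀ f → 1 ℕ.* 1 ℕ.* (1 ℕ.* f) ≡ f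
    one*one*one* = ℕ-Solver.solve-∀
    cross : (n C j) ℕ.* 1 ℕ.* (j ! ℕ.* (n ∸ j) !) ≡ 1 ℕ.* 1 ℕ.* (1 ℕ.* n !)
    cross = trans (cong (ℕ._* (j ! ℕ.* (n ∸ j) !)) (ℕ.*-identityʳ (n C j)))
      (trans (choose*factorials j≤n) (sym (one*one*one* (n !))))

  sumℚ-applyUpTo-cong : ∀ n {f g : ℕ → ℚ} → (∀ {i} → i < n → f i ≡ g i) →
                        sumℚ (applyUpTo f n) ≡ sumℚ (applyUpTo g n)
  sumℚ-applyUpTo-cong zero    f≡g = refl
  sumℚ-applyUpTo-cong (suc n) f≡g =
    cong₂ _+_ (f≡g (s≤s z≤n)) (sumℚ-applyUpTo-cong n (λ i<n → f≡g (s≤s i<n)))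

  sumℚ-applyUpTo-suc : ∀ n (f : ℕ → ℚ) → sumℚ (applyUpTo f (suc n)) ≡ sumℚ (applyUpTo f n) + f n
  sumℚ-applyUpTo-suc zero    f = trans (ℚ.+-identityʳ (f 0)) (sym (ℚ.+-identityˡ (f 0)))
  sumℚ-applyUpTo-suc (suc n) f = trans (cong (_+_ (f 0)) (sumℚ-applyUpTo-suc n (λ i → f (suc i))))
    (sym (ℚ.+-assoc (f 0) _ _))

  *-distribˡ-sumℚ : ∀ c n (f : ℕ → ℚ) → c * sumℚ (applyUpTo f n) ≡ sumℚ (applyUpTo (λ i → c * f i) n)
  *-distribˡ-sumℚ c zero    f = ℚ.*-zeroʳ c
  *-distribˡ-sumℚ c (suc n) f = trans (ℚ.*-distribˡ-+ c (f 0) _)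
    (cong (_+_ (c * f 0)) (*-distribˡ-sumℚ c n (λ i → f (suc i))))

  zipWith-applyUpTo : ∀ {A B C : Set} (g : A → B → C) (f : ℕ → A) (h : ℕ → B) n →
    zipWith g (applyUpTo f n) (applyUpTo h n) ≡ applyUpTo (λ i → g (f i) (h i)) n
  zipWith-applyUpTo g f h zero    = refl
  zipWith-applyUpTo g f h (suc n) =
    cong (g (f 0) (h 0) ∷_) (zipWith-applyUpTo g (λ i → f (suc i)) (λ i → h (suc i)) n)

  bernList≡applyUpTo : ∀ n → bernList n ≡ applyUpTo bernoulli n
  bernList≡applyUpTo zero    = refl
  bernList≡applyUpTo (suc n) =
    trans (cong (_∷ʳ bernoulli n) (bernList≡applyUpTo n)) (List.applyUpTo-∷ʳ bernoulli n)

  bernoulli-suc : ∀ m → bernoulli (suc m) ≡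
    - ((+ 1 / suc (suc m)) * sumℚ (applyUpTo (λ j → ℕ→ℚ (suc (suc m) C j) * bernoulli j) (suc m)))
  bernoulli-suc m = cong (λ l → - ((+ 1 / suc (suc m)) * sumℚ l))
    (trans (cong (zipWith binomial (upTo (suc m))) (bernList≡applyUpTo (suc m)))
      (zipWith-applyUpTo binomial (λ j → j) bernoulli (suc m)))
    where
    binomial : ℕ → ℚ → ℚ
    binomial j b = ℕ→ℚ (suc (suc m) C j) * b

  bernoulli-binomial-sum : ∀ m →
    sumℚ (applyUpTo (λ j → ℕ→ℚ (suc (suc m) C j) * bernoulli j) (suc (suc m))) ≡ 0ℚ
  bernoulli-binomial-sum m = begin
    sumℚ (applyUpTo h N)                                 ≡⟨ sumℚ-applyUpTo-suc (suc m) h ⟩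
    S + ℕ→ℚ (N C suc m) * bernoulli (suc m)             ≡⟨ cong (λ k → S + ℕ→ℚ k * bernoulli (suc m)) N-choose-pred ⟩
    S + ℕ→ℚ N * bernoulli (suc m)                       ≡⟨ cong (λ b → S + ℕ→ℚ N * b) (bernoulli-suc m) ⟩
    S + ℕ→ℚ N * - ((+ 1 / N) * S)                       ≡⟨ factor S (+ 1 / N) (ℕ→ℚ N) ⟩
    S * (1ℚ - (+ 1 / N) * ℕ→ℚ N)                        ≡⟨ cong (λ q → S * (1ℚ - q)) (1/[1+n]*[1+n]≡1 (suc m)) ⟩
    S * 0ℚ                                              ≡⟨ ℚ.*-zeroʳ S ⟩
    0ℚ                                                  ∎
    where
    open ≡-Reasoning
    N = suc (suc m)
    h : ℕ → ℚ
    h j = ℕ→ℚ (N C j) * bernoulli j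
    S = sumℚ (applyUpTo h (suc m))
    N-choose-pred : N C suc m ≡ N
    N-choose-pred = trans (nCk≡nC[n∸k] (ℕ.n≤1+n (suc m)))
      (trans (cong (N C_) (ℕ.m+n∸n≡m 1 (suc m))) (nC1≡n N))
    factor : ∀ s i n → s + n * - (i * s) ≡ s * (1ℚ - i * n)
    factor = solve-∀ ℚ-ring

  -- Formal power series over ℚ

  Series : Set
  Series = ℕ → ℚ

  infix  4 _≋_
  infixl 6 _+ₛ_ _-ₛ_
  infixl 7 _*ₛ_
  infixr 8 _·_
  infix  9 -ₛ_

  _≋_ : Series → Series → Set
  u ≋ v = ∀ n → u n ≡ v n

  _+ₛ_ : Series → Series → Series
  (u +ₛ v) n = u n + v n

  -ₛ_ : Series → Series
  (-ₛ u) n = - u n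

  _-ₛ_ : Series → Series → Series
  u -ₛ v = u +ₛ -ₛ v

  _·_ : ℚ → Series → Series
  (c · u) n = c * u n

  0ₛ : Series
  0ₛ _ = 0ℚ

  1ₛ : Series
  1ₛ zero    = 1ℚ
  1ₛ (suc _) = 0ℚ

  tₛ : Series
  tₛ zero    = 0ℚ
  tₛ (suc n) = 1ₛ n

  shift : Series → Series
  shift u n = u (suc n)

  _*ₛ_ : Series → Series → Series
  (u *ₛ v) zero    = u 0 * v 0
  (u *ₛ v) (suc n) = u 0 * v (suc n) + (shift u *ₛ v) n

  *ₛ-cong : ∀ {u u′ v v′} → u ≋ u′ → v ≋ v′ → u *ₛ v ≋ u′ *ₛ v′
  *ₛ-cong u≋u′ v≋v′ zero    = cong₂ _*_ (u≋u′ 0) (v≋v′ 0)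
  *ₛ-cong u≋u′ v≋v′ (suc n) =
    cong₂ _+_ (cong₂ _*_ (u≋u′ 0) (v≋v′ (suc n))) (*ₛ-cong (λ i → u≋u′ (suc i)) v≋v′ n)

  *ₛ-distribʳ : ∀ w u v → (u +ₛ v) *ₛ w ≋ u *ₛ w +ₛ v *ₛ w
  *ₛ-distribʳ w u v zero    = ℚ.*-distribʳ-+ (w 0) (u 0) (v 0)
  *ₛ-distribʳ w u v (suc n) = trans
    (cong₂ _+_ (ℚ.*-distribʳ-+ (w (suc n)) (u 0) (v 0)) (*ₛ-distribʳ w (shift u) (shift v) n))
    (interchange (u 0 * w (suc n)) _ _ _)
    where
    interchange : ∀ a b c d → (a + b) + (c + d) ≡ (a + c) + (b + d)
    interchange = solve-∀ ℚ-ring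

  ·-*ₛ-assoc : ∀ c u v → (c · u) *ₛ v ≋ c · (u *ₛ v)
  ·-*ₛ-assoc c u v zero    = ℚ.*-assoc c (u 0) (v 0)
  ·-*ₛ-assoc c u v (suc n) = trans
    (cong₂ _+_ (ℚ.*-assoc c (u 0) (v (suc n))) (·-*ₛ-assoc c (shift u) v n))
    (sym (ℚ.*-distribˡ-+ c _ _))

  *ₛ-zeroˡ : ∀ u → 0ₛ *ₛ u ≋ 0ₛ
  *ₛ-zeroˡ u zero    = ℚ.*-zeroˡ (u 0)
  *ₛ-zeroˡ u (suc n) = cong₂ _+_ (ℚ.*-zeroˡ (u (suc n))) (*ₛ-zeroˡ u n)

  *ₛ-identityˡ : ∀ u → 1ₛ *ₛ u ≋ u
  *ₛ-identityˡ u zero    = ℚ.*-identityˡ (u 0)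
  *ₛ-identityˡ u (suc n) = trans (cong₂ _+_ (ℚ.*-identityˡ (u (suc n))) (*ₛ-zeroˡ u n))
    (ℚ.+-identityʳ (u (suc n)))

  *ₛ-snoc : ∀ u v n → (u *ₛ v) (suc n) ≡ (u *ₛ shift v) n + u (suc n) * v 0
  *ₛ-snoc u v zero    = refl
  *ₛ-snoc u v (suc n) = trans (cong (_+_ (u 0 * v (suc (suc n)))) (*ₛ-snoc (shift u) v n))
    (sym (ℚ.+-assoc (u 0 * v (suc (suc n))) _ _))

  *ₛ-comm : ∀ u v → u *ₛ v ≋ v *ₛ u
  *ₛ-comm u v zero    = ℚ.*-comm (u 0) (v 0)
  *ₛ-comm u v (suc n) = trans (cong (_+_ (u 0 * v (suc n))) (*ₛ-comm (shift u) v n))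
    (trans (swap (u 0) (v (suc n)) _) (sym (*ₛ-snoc v u n)))
    where
    swap : ∀ a b c → a * b + c ≡ c + b * a
    swap = solve-∀ ℚ-ring

  *ₛ-assoc : ∀ u v w → (u *ₛ v) *ₛ w ≋ u *ₛ (v *ₛ w)
  *ₛ-assoc u v w zero    = ℚ.*-assoc (u 0) (v 0) (w 0)
  *ₛ-assoc u v w (suc n) = begin
    (u 0 * v 0) * w (suc n) + (shift (u *ₛ v) *ₛ w) n
      ≡⟨ cong (_+_ ((u 0 * v 0) * w (suc n))) (*ₛ-distribʳ w (u 0 · shift v) (shift u *ₛ v) n) ⟩
    (u 0 * v 0) * w (suc n) + (((u 0 · shift v) *ₛ w) n + ((shift u *ₛ v) *ₛ w) n)
      ≡⟨ cong₂ (λ p q → (u 0 * v 0) * w (suc n) + (p + q))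
           (·-*ₛ-assoc (u 0) (shift v) w n) (*ₛ-assoc (shift u) v w n) ⟩
    (u 0 * v 0) * w (suc n) + (u 0 * (shift v *ₛ w) n + (shift u *ₛ (v *ₛ w)) n)
      ≡⟨ regroup (u 0) (v 0) (w (suc n)) _ _ ⟩
    u 0 * (v 0 * w (suc n) + (shift v *ₛ w) n) + (shift u *ₛ (v *ₛ w)) n ∎
    where
    open ≡-Reasoning
    regroup : ∀ a b c d e → (a * b) * c + (a * d + e) ≡ a * (b * c + d) + e
    regroup = solve-∀ ℚ-ring

  *ₛ-identityʳ : ∀ u → u *ₛ 1ₛ ≋ u
  *ₛ-identityʳ u n = trans (*ₛ-comm u 1ₛ n) (*ₛ-identityˡ u n)

  *ₛ-distribˡ : ∀ u v w → u *ₛ (v +ₛ w) ≋ u *ₛ v +ₛ u *ₛ w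
  *ₛ-distribˡ u v w n = trans (*ₛ-comm u (v +ₛ w) n)
    (trans (*ₛ-distribʳ u v w n) (cong₂ _+_ (*ₛ-comm v u n) (*ₛ-comm w u n)))

  *ₛ-as-sum : ∀ u v n → (u *ₛ v) n ≡ sumℚ (applyUpTo (λ i → u i * v (n ∸ i)) (suc n))
  *ₛ-as-sum u v zero    = sym (ℚ.+-identityʳ (u 0 * v 0))
  *ₛ-as-sum u v (suc n) = cong (_+_ (u 0 * v (suc n))) (*ₛ-as-sum (shift u) v n)

  seriesRing : CommutativeRing 0ℓ 0ℓ
  seriesRing = record
    { Carrier = Series
    ; _≈_ = _≋_
    ; _+_ = _+ₛ_
    ; _*_ = _*ₛ_
    ; -_ = -ₛ_
    ; 0# = 0ₛ
    ; 1# = 1ₛ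
    ; isCommutativeRing = record
      { isRing = record
        { +-isAbelianGroup = Pointwise.isAbelianGroup ℕ ℚ.+-0-isAbelianGroup
        ; *-cong = *ₛ-cong
        ; *-assoc = *ₛ-assoc
        ; *-identity = *ₛ-identityˡ , *ₛ-identityʳ
        ; distrib = *ₛ-distribˡ , *ₛ-distribʳ
        }
      ; *-comm = *ₛ-comm
      }
    }

  open CommutativeRing seriesRing using ()
    renaming (setoid to ≋-setoid; refl to ≋-refl; sym to ≋-sym; trans to ≋-trans; +-cong to +ₛ-cong; -‿cong to -ₛ-cong)

  module ≋-Reasoning = SetoidReasoning ≋-setoid

  cst : ℚ → Series
  cst c = c · 1ₛ

  cst-one : cst 1ℚ ≋ 1ₛ
  cst-one n = ℚ.*-identityˡ (1ₛ n)

  cst-morphism : ℚ.+-*-rawRing -Raw-AlmostCommutative⟶ fromCommutativeRing seriesRing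
  cst-morphism = record
    { ⟦_⟧    = cst
    ; +-homo = λ p q n → ℚ.*-distribʳ-+ (1ₛ n) p q
    ; *-homo = λ p q n → trans (ℚ.*-assoc p q (1ₛ n))
        (sym (trans (·-*ₛ-assoc p 1ₛ (cst q) n) (cong (p *_) (*ₛ-identityˡ (cst q) n))))
    ; -‿homo = λ p n → sym (ℚ.neg-distribˡ-* p (1ₛ n))
    ; 0-homo = λ n → ℚ.*-zeroˡ (1ₛ n)
    ; 1-homo = cst-one
    }

  cst≟ : ∀ p q → Maybe (cst p ≋ cst q)
  cst≟ p q = Maybe.map (λ p≡q n → cong (_* 1ₛ n) p≡q) (dec⇒maybe (p ℚ.≟ q))

  open RingSolver ℚ.+-*-rawRing (fromCommutativeRing seriesRing) cst-morphism cst≟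
    using (solve; _:=_; _:+_; _:*_; _:-_; :-_; con)

  ·≋cst*ₛ : ∀ c u → c · u ≋ cst c *ₛ u
  ·≋cst*ₛ c u n = sym (trans (·-*ₛ-assoc c 1ₛ u n) (cong (c *_) (*ₛ-identityˡ u n)))

  ·-cancel : ∀ {c u v} → c ≢ 0ℚ → c · u ≋ c · v → u ≋ v
  ·-cancel c≢0 cu≋cv n = *-cancelˡ-≢0 c≢0 (cu≋cv n)

  tₛ*ₛ-suc : ∀ u n → (tₛ *ₛ u) (suc n) ≡ u n
  tₛ*ₛ-suc u n = trans (cong₂ _+_ (ℚ.*-zeroˡ (u (suc n))) (*ₛ-identityˡ u n)) (ℚ.+-identityˡ (u n))

  tₛ*ₛ-cancel : ∀ {u v} → tₛ *ₛ u ≋ tₛ *ₛ v → u ≋ v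
  tₛ*ₛ-cancel {u} {v} tu≋tv n = trans (sym (tₛ*ₛ-suc u n)) (trans (tu≋tv (suc n)) (tₛ*ₛ-suc v n))

  θ : Series → Series
  θ u n = ℕ→ℚ n * u n

  shift-θ : ∀ u → shift (θ u) ≋ θ (shift u) +ₛ shift u
  shift-θ u n = trans (cong (_* u (suc n)) (ℕ→ℚ-suc n)) (distrib (ℕ→ℚ n) (u (suc n)))
    where
    distrib : ∀ k a → (k + 1ℚ) * a ≡ k * a + a
    distrib = solve-∀ ℚ-ring

  θ-leibniz : ∀ u v → θ (u *ₛ v) ≋ θ u *ₛ v +ₛ u *ₛ θ v
  θ-leibniz u v zero    = zero-case (u 0) (v 0)
    where
    zero-case : ∀ a b → 0ℚ * (a * b) ≡ (0ℚ * a) * b + a * (0ℚ * b)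
    zero-case = solve-∀ ℚ-ring
  θ-leibniz u v (suc n) = begin
    N′ * (u 0 * v (suc n) + W)                           ≡⟨ cong (_* (u 0 * v (suc n) + W)) (ℕ→ℚ-suc n) ⟩
    (N + 1ℚ) * (u 0 * v (suc n) + W)                     ≡⟨ expand N (u 0) (v (suc n)) W ⟩
    u 0 * ((N + 1ℚ) * v (suc n)) + (N * W + W)           ≡⟨ cong₂ (λ k p → u 0 * (k * v (suc n)) + (p + W))
                                                                (sym (ℕ→ℚ-suc n)) (θ-leibniz (shift u) v n) ⟩
    u 0 * (N′ * v (suc n)) + ((A + B) + W)               ≡⟨ regroup (u 0) (v (suc n)) N′ A B W ⟩
    (0ℚ * u 0) * v (suc n) + (A + W) + (u 0 * (N′ * v (suc n)) + B)
      ≡⟨ cong (λ p → (0ℚ * u 0) * v (suc n) + p + (u 0 * (N′ * v (suc n)) + B)) shift-θ-term ⟨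
    (θ u *ₛ v +ₛ u *ₛ θ v) (suc n)                       ∎
    where
    open ≡-Reasoning
    N = ℕ→ℚ n
    N′ = ℕ→ℚ (suc n)
    W = (shift u *ₛ v) n
    A = (θ (shift u) *ₛ v) n
    B = (shift u *ₛ θ v) n
    shift-θ-term : (shift (θ u) *ₛ v) n ≡ A + W
    shift-θ-term = trans (*ₛ-cong (shift-θ u) (λ _ → refl) n) (*ₛ-distribʳ v (θ (shift u)) (shift u) n)
    expand : ∀ k a b w → (k + 1ℚ) * (a * b + w) ≡ a * ((k + 1ℚ) * b) + (k * w + w)
    expand = solve-∀ ℚ-ring
    regroup : ∀ a b k x y w → a * (k * b) + ((x + y) + w) ≡ (0ℚ * a) * b + (x + w) + (a * (k * b) + y)
    regroup = solve-∀ ℚ-ring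

  θ-unique : ∀ c {u v} → θ u ≋ c · (tₛ *ₛ u) → θ v ≋ c · (tₛ *ₛ v) → u 0 ≡ v 0 → u ≋ v
  θ-unique c θu θv u₀≡v₀ zero = u₀≡v₀
  θ-unique c {u} {v} θu θv u₀≡v₀ (suc n) = *-cancelˡ-≢0 (ℕ→ℚ-suc≢0 n) (begin
    ℕ→ℚ (suc n) * u (suc n)   ≡⟨ θu (suc n) ⟩
    c * (tₛ *ₛ u) (suc n)     ≡⟨ cong (c *_) (tₛ*ₛ-suc u n) ⟩
    c * u n                   ≡⟨ cong (c *_) (θ-unique c θu θv u₀≡v₀ n) ⟩
    c * v n                   ≡⟨ cong (c *_) (tₛ*ₛ-suc v n) ⟨
    c * (tₛ *ₛ v) (suc n)     ≡⟨ θv (suc n) ⟨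
    ℕ→ℚ (suc n) * v (suc n)   ∎)
    where open ≡-Reasoning

  scale : ℚ → Series → Series
  scale c u n = c ^ℕ n * u n

  scale-*ₛ : ∀ c u v → scale c (u *ₛ v) ≋ scale c u *ₛ scale c v
  scale-*ₛ c u v zero    = one-case (u 0) (v 0)
    where
    one-case : ∀ a b → 1ℚ * (a * b) ≡ (1ℚ * a) * (1ℚ * b)
    one-case = solve-∀ ℚ-ring
  scale-*ₛ c u v (suc n) = begin
    (c * p) * (u 0 * v (suc n) + (shift u *ₛ v) n)
      ≡⟨ regroup c p (u 0) (v (suc n)) _ ⟩
    (1ℚ * u 0) * ((c * p) * v (suc n)) + c * (p * (shift u *ₛ v) n)
      ≡⟨ cong (λ w → (1ℚ * u 0) * ((c * p) * v (suc n)) + c * w) (scale-*ₛ c (shift u) v n) ⟩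
    (1ℚ * u 0) * ((c * p) * v (suc n)) + c * (scale c (shift u) *ₛ scale c v) n
      ≡⟨ cong (_+_ ((1ℚ * u 0) * ((c * p) * v (suc n))))
           (trans (sym (·-*ₛ-assoc c (scale c (shift u)) (scale c v) n))
             (*ₛ-cong (λ i → sym (ℚ.*-assoc c (c ^ℕ i) (u (suc i)))) (λ _ → refl) n)) ⟩
    (scale c u *ₛ scale c v) (suc n) ∎
    where
    open ≡-Reasoning
    p = c ^ℕ n
    regroup : ∀ c p a b w → (c * p) * (a * b + w) ≡ (1ℚ * a) * ((c * p) * b) + c * (p * w)
    regroup = solve-∀ ℚ-ring

  scale-tₛ : ∀ c → scale c tₛ ≋ c · tₛ
  scale-tₛ c zero          = trans (ℚ.*-zeroʳ 1ℚ) (sym (ℚ.*-zeroʳ c))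
  scale-tₛ c (suc zero)    = cong (_* 1ℚ) (ℚ.*-identityʳ c)
  scale-tₛ c (suc (suc n)) = trans (ℚ.*-zeroʳ (c ^ℕ suc (suc n))) (sym (ℚ.*-zeroʳ c))

  -- Exponential series

  exp : ℚ → Series
  exp c = scale c invFact

  expm1 : ℚ → Series
  expm1 c = scale c (invFact -ₛ 1ₛ)

  θ-exp : ∀ c → θ (exp c) ≋ c · (tₛ *ₛ exp c)
  θ-exp c zero    = zero-case c (exp c 0)
    where
    zero-case : ∀ c e → 0ℚ * e ≡ c * (0ℚ * e)
    zero-case = solve-∀ ℚ-ring
  θ-exp c (suc n) = begin
    ℕ→ℚ (suc n) * ((c * c ^ℕ n) * invFact (suc n))   ≡⟨ regroup (ℕ→ℚ (suc n)) c (c ^ℕ n) (invFact (suc n)) ⟩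
    c * (c ^ℕ n * (ℕ→ℚ (suc n) * invFact (suc n)))   ≡⟨ cong (λ f → c * (c ^ℕ n * f)) (ℕ→ℚ-suc*invFact n) ⟩
    c * exp c n                                        ≡⟨ cong (c *_) (tₛ*ₛ-suc (exp c) n) ⟨
    c * (tₛ *ₛ exp c) (suc n)                          ∎
    where
    open ≡-Reasoning
    regroup : ∀ k c p f → k * ((c * p) * f) ≡ c * (p * (k * f))
    regroup = solve-∀ ℚ-ring

  exp-+ : ∀ a b → exp a *ₛ exp b ≋ exp (a + b)
  exp-+ a b = θ-unique (a + b) θ-product (θ-exp (a + b)) refl
    where
    open ≋-Reasoning
    θ-product : θ (exp a *ₛ exp b) ≋ (a + b) · (tₛ *ₛ (exp a *ₛ exp b))
    θ-product = begin
      θ (exp a *ₛ exp b)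
        ≈⟨ θ-leibniz (exp a) (exp b) ⟩
      θ (exp a) *ₛ exp b +ₛ exp a *ₛ θ (exp b)
        ≈⟨ +ₛ-cong (*ₛ-cong (≋-trans (θ-exp a) (·≋cst*ₛ a _)) ≋-refl)
                   (*ₛ-cong ≋-refl (≋-trans (θ-exp b) (·≋cst*ₛ b _))) ⟩
      (cst a *ₛ (tₛ *ₛ exp a)) *ₛ exp b +ₛ exp a *ₛ (cst b *ₛ (tₛ *ₛ exp b))
        ≈⟨ solve 5 (λ A B T E F → (A :* (T :* E)) :* F :+ E :* (B :* (T :* F)) := (A :+ B) :* (T :* (E :* F)))
                   (λ _ → refl) (cst a) (cst b) tₛ (exp a) (exp b) ⟩
      (cst a +ₛ cst b) *ₛ (tₛ *ₛ (exp a *ₛ exp b))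
        ≈⟨ *ₛ-cong (λ n → sym (ℚ.*-distribʳ-+ (1ₛ n) a b)) ≋-refl ⟩
      cst (a + b) *ₛ (tₛ *ₛ (exp a *ₛ exp b))
        ≈⟨ ·≋cst*ₛ (a + b) _ ⟨
      (a + b) · (tₛ *ₛ (exp a *ₛ exp b)) ∎

  1ₛ+expm1 : ∀ c → 1ₛ +ₛ expm1 c ≋ exp c
  1ₛ+expm1 c zero    = refl
  1ₛ+expm1 c (suc n) = cancel (c ^ℕ suc n) (invFact (suc n))
    where
    cancel : ∀ p f → 0ℚ + p * (f + - 0ℚ) ≡ p * f
    cancel = solve-∀ ℚ-ring

  expm1-+ : ∀ a b {s} → a + b ≡ s → expm1 a +ₛ expm1 b +ₛ expm1 a *ₛ expm1 b ≋ expm1 s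
  expm1-+ a b {s} a+b≡s = begin
    expm1 a +ₛ expm1 b +ₛ expm1 a *ₛ expm1 b
      ≈⟨ solve 2 (λ A B → A :+ B :+ A :* B := (con 1ℚ :+ A) :* (con 1ℚ :+ B) :- con 1ℚ)
                 (λ _ → refl) (expm1 a) (expm1 b) ⟩
    (cst 1ℚ +ₛ expm1 a) *ₛ (cst 1ℚ +ₛ expm1 b) -ₛ cst 1ℚ
      ≈⟨ +ₛ-cong (≋-trans (*ₛ-cong (cst-one+expm1 a) (cst-one+expm1 b)) (exp-+ a b)) ≋-refl ⟩
    exp (a + b) -ₛ cst 1ℚ
      ≈⟨ +ₛ-cong (λ n → cong (λ c → exp c n) a+b≡s) ≋-refl ⟩
    exp s -ₛ cst 1ℚ
      ≈⟨ +ₛ-cong (cst-one+expm1 s) ≋-refl ⟨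
    (cst 1ℚ +ₛ expm1 s) -ₛ cst 1ℚ
      ≈⟨ solve 1 (λ E → (con 1ℚ :+ E) :- con 1ℚ := E) (λ _ → refl) (expm1 s) ⟩
    expm1 s ∎
    where
    open ≋-Reasoning
    cst-one+expm1 : ∀ c → cst 1ℚ +ₛ expm1 c ≋ exp c
    cst-one+expm1 c n = trans (cong (_+ expm1 c n) (cst-one n)) (1ₛ+expm1 c n)

  expm1-zero : expm1 0ℚ ≋ 0ₛ
  expm1-zero zero    = refl
  expm1-zero (suc n) = trans (cong (_* e) (ℚ.*-zeroˡ (0ℚ ^ℕ n))) (ℚ.*-zeroˡ e)
    where e = (invFact -ₛ 1ₛ) (suc n)

  -- Bernoulli series

  bernoulli-gf : bf bernoulli *ₛ invFact ≋ bf bernoulli +ₛ tₛ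
  bernoulli-gf zero          = refl
  bernoulli-gf (suc zero)    = refl
  bernoulli-gf (suc (suc m)) = begin
    (bf bernoulli *ₛ invFact) N
      ≡⟨ *ₛ-as-sum (bf bernoulli) invFact N ⟩
    sumℚ (applyUpTo (λ j → bf bernoulli j * invFact (N ∸ j)) (suc N))
      ≡⟨ sumℚ-applyUpTo-cong (suc N) (λ j<1+N → binomial-term (ℕ.≤-pred j<1+N)) ⟩
    sumℚ (applyUpTo (λ j → invFact N * h j) (suc N))
      ≡⟨ *-distribˡ-sumℚ (invFact N) (suc N) h ⟨
    invFact N * sumℚ (applyUpTo h (suc N))
      ≡⟨ cong (invFact N *_) (sumℚ-applyUpTo-suc N h) ⟩
    invFact N * (sumℚ (applyUpTo h N) + ℕ→ℚ (N C N) * bernoulli N)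
      ≡⟨ cong₂ (λ s k → invFact N * (s + ℕ→ℚ k * bernoulli N)) (bernoulli-binomial-sum m) (nCn≡1 N) ⟩
    invFact N * (0ℚ + 1ℚ * bernoulli N)
      ≡⟨ regroup (invFact N) (bernoulli N) ⟩
    bf bernoulli N + 0ℚ ∎
    where
    open ≡-Reasoning
    N = suc (suc m)
    h : ℕ → ℚ
    h j = ℕ→ℚ (N C j) * bernoulli j
    binomial-term : ∀ {j} → j ≤ N → bf bernoulli j * invFact (N ∸ j) ≡ invFact N * h j
    binomial-term {j} j≤N = trans (ℚ.*-assoc (bernoulli j) (invFact j) (invFact (N ∸ j)))
      (trans (cong (bernoulli j *_) (sym (choose*invFact j≤N)))
        (swap (bernoulli j) (ℕ→ℚ (N C j)) (invFact N)))
      where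
      swap : ∀ b k f → b * (k * f) ≡ f * (k * b)
      swap = solve-∀ ℚ-ring
    regroup : ∀ f b → f * (0ℚ + 1ℚ * b) ≡ b * f + 0ℚ
    regroup = solve-∀ ℚ-ring

  bernoulli-gf-expm1 : bf bernoulli *ₛ (invFact -ₛ 1ₛ) ≋ tₛ
  bernoulli-gf-expm1 = begin
    B *ₛ (invFact -ₛ 1ₛ)       ≈⟨ *ₛ-cong ≋-refl (λ n → cong (λ o → invFact n - o) (cst-one n)) ⟨
    B *ₛ (invFact -ₛ cst 1ℚ)   ≈⟨ solve 2 (λ B E → B :* (E :- con 1ℚ) := B :* E :- B) (λ _ → refl) B invFact ⟩
    B *ₛ invFact -ₛ B          ≈⟨ +ₛ-cong bernoulli-gf ≋-refl ⟩
    B +ₛ tₛ -ₛ B               ≈⟨ solve 2 (λ B T → B :+ T :- B := T) (λ _ → refl) B tₛ ⟩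
    tₛ                         ∎
    where
    open ≋-Reasoning
    B = bf bernoulli

  powPred : (a : ℚ) → a ≢ 0ℚ → ℕ → ℚ
  powPred a a≢0 n = powℤ a a≢0 ((+ n) ℤ.- (+ 1))

  *-powPred : ∀ a a≢0 n → a * powPred a a≢0 n ≡ a ^ℕ n
  *-powPred a a≢0 zero    = trans (cong (a *_) (ℚ.*-identityʳ (1/ a))) (ℚ.*-inverseʳ a)
    where instance _ = ≢-nonZero a≢0
  *-powPred a a≢0 (suc n) = refl

  -- The series Σ Bₙ aⁿ⁻¹ tⁿ/n! of t/(e^{a t} - 1).
  bernAt : (a : ℚ) → a ≢ 0ℚ → Series
  bernAt a a≢0 n = bf bernoulli n * powPred a a≢0 n

  bernAt-scale : ∀ a a≢0 → a · bernAt a a≢0 ≋ scale a (bf bernoulli)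
  bernAt-scale a a≢0 n =
    trans (swap a (bf bernoulli n) (powPred a a≢0 n)) (cong (_* bf bernoulli n) (*-powPred a a≢0 n))
    where
    swap : ∀ a b p → a * (b * p) ≡ (a * p) * b
    swap = solve-∀ ℚ-ring

  bernAt*expm1 : ∀ a a≢0 → bernAt a a≢0 *ₛ expm1 a ≋ tₛ
  bernAt*expm1 a a≢0 = ·-cancel a≢0 (begin
    a · (bernAt a a≢0 *ₛ expm1 a)                         ≈⟨ ·-*ₛ-assoc a (bernAt a a≢0) (expm1 a) ⟨
    (a · bernAt a a≢0) *ₛ expm1 a                         ≈⟨ *ₛ-cong (bernAt-scale a a≢0) ≋-refl ⟩
    scale a (bf bernoulli) *ₛ scale a (invFact -ₛ 1ₛ)     ≈⟨ scale-*ₛ a (bf bernoulli) (invFact -ₛ 1ₛ) ⟨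
    scale a (bf bernoulli *ₛ (invFact -ₛ 1ₛ))             ≈⟨ (λ n → cong (a ^ℕ n *_) (bernoulli-gf-expm1 n)) ⟩
    scale a tₛ                                            ≈⟨ scale-tₛ a ⟩
    a · tₛ                                                ∎)
    where open ≋-Reasoning

  *ₛ-cancelʳ-factor-of-t : ∀ {u v w g} → g *ₛ w ≋ tₛ → u *ₛ w ≋ v *ₛ w → u ≋ v
  *ₛ-cancelʳ-factor-of-t {u} {v} {w} {g} gw≋t uw≋vw = tₛ*ₛ-cancel (begin
    tₛ *ₛ u          ≈⟨ *ₛ-cong gw≋t ≋-refl ⟨
    (g *ₛ w) *ₛ u    ≈⟨ solve 3 (λ G W U → (G :* W) :* U := (U :* W) :* G) (λ _ → refl) g w u ⟩
    (u *ₛ w) *ₛ g    ≈⟨ *ₛ-cong uw≋vw ≋-refl ⟩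
    (v *ₛ w) *ₛ g    ≈⟨ solve 3 (λ G W V → (V :* W) :* G := (G :* W) :* V) (λ _ → refl) g w v ⟩
    (g *ₛ w) *ₛ v    ≈⟨ *ₛ-cong gw≋t ≋-refl ⟩
    tₛ *ₛ v          ∎)
    where open ≋-Reasoning

  *ₛ-cancelʳ-expm1² : ∀ {a b u v} (a≢0 : a ≢ 0ℚ) (b≢0 : b ≢ 0ℚ) →
    u *ₛ (expm1 a *ₛ expm1 b) ≋ v *ₛ (expm1 a *ₛ expm1 b) → u ≋ v
  *ₛ-cancelʳ-expm1² {a} {b} {u} {v} a≢0 b≢0 eq =
    *ₛ-cancelʳ-factor-of-t (bernAt*expm1 a a≢0) (*ₛ-cancelʳ-factor-of-t (bernAt*expm1 b b≢0)
      (≋-trans (*ₛ-assoc u (expm1 a) (expm1 b)) (≋-trans eq (≋-sym (*ₛ-assoc v (expm1 a) (expm1 b))))))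

  -- Both relations below follow from this one by cancelling e^{a t} - 1 and e^{b t} - 1.
  bernAt-sum*expm1² : ∀ a b {s} (a≢0 : a ≢ 0ℚ) (b≢0 : b ≢ 0ℚ) → a + b ≡ s →
    (bernAt a a≢0 +ₛ bernAt b b≢0 +ₛ tₛ) *ₛ (expm1 a *ₛ expm1 b) ≋ tₛ *ₛ expm1 s
  bernAt-sum*expm1² a b a≢0 b≢0 a+b≡s = begin
    (Fa +ₛ Fb +ₛ tₛ) *ₛ (Ea *ₛ Eb)
      ≈⟨ solve 5 (λ Fa Fb T Ea Eb → (Fa :+ Fb :+ T) :* (Ea :* Eb)
                   := (Fa :* Ea) :* Eb :+ (Fb :* Eb) :* Ea :+ T :* (Ea :* Eb))
                 (λ _ → refl) Fa Fb tₛ Ea Eb ⟩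
    (Fa *ₛ Ea) *ₛ Eb +ₛ (Fb *ₛ Eb) *ₛ Ea +ₛ tₛ *ₛ (Ea *ₛ Eb)
      ≈⟨ +ₛ-cong (+ₛ-cong (*ₛ-cong (bernAt*expm1 a a≢0) ≋-refl) (*ₛ-cong (bernAt*expm1 b b≢0) ≋-refl)) ≋-refl ⟩
    tₛ *ₛ Eb +ₛ tₛ *ₛ Ea +ₛ tₛ *ₛ (Ea *ₛ Eb)
      ≈⟨ solve 3 (λ T Ea Eb → T :* Eb :+ T :* Ea :+ T :* (Ea :* Eb) := T :* (Ea :+ Eb :+ Ea :* Eb))
                 (λ _ → refl) tₛ Ea Eb ⟩
    tₛ *ₛ (Ea +ₛ Eb +ₛ Ea *ₛ Eb)
      ≈⟨ *ₛ-cong ≋-refl (expm1-+ a b a+b≡s) ⟩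
    tₛ *ₛ expm1 _ ∎
    where
    open ≋-Reasoning
    Fa = bernAt a a≢0
    Fb = bernAt b b≢0
    Ea = expm1 a
    Eb = expm1 b

  bernAt+bernAt : ∀ a b (a≢0 : a ≢ 0ℚ) (b≢0 : b ≢ 0ℚ) → a + b ≡ 0ℚ →
    bernAt a a≢0 +ₛ bernAt b b≢0 +ₛ tₛ ≋ 0ₛ
  bernAt+bernAt a b a≢0 b≢0 a+b≡0 = *ₛ-cancelʳ-expm1² a≢0 b≢0 (begin
    (bernAt a a≢0 +ₛ bernAt b b≢0 +ₛ tₛ) *ₛ E²  ≈⟨ bernAt-sum*expm1² a b a≢0 b≢0 a+b≡0 ⟩
    tₛ *ₛ expm1 0ℚ                             ≈⟨ *ₛ-cong ≋-refl expm1-zero ⟩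
    tₛ *ₛ 0ₛ                                   ≈⟨ ≋-trans (*ₛ-comm tₛ 0ₛ) (*ₛ-zeroˡ tₛ) ⟩
    0ₛ                                         ≈⟨ *ₛ-zeroˡ E² ⟨
    0ₛ *ₛ E²                                   ∎)
    where
    open ≋-Reasoning
    E² = expm1 a *ₛ expm1 b

  bernAt*bernAt : ∀ a b {s} (a≢0 : a ≢ 0ℚ) (b≢0 : b ≢ 0ℚ) (s≢0 : s ≢ 0ℚ) → a + b ≡ s →
    bernAt a a≢0 *ₛ bernAt b b≢0 ≋ (bernAt a a≢0 +ₛ bernAt b b≢0 +ₛ tₛ) *ₛ bernAt s s≢0
  bernAt*bernAt a b {s} a≢0 b≢0 s≢0 a+b≡s = *ₛ-cancelʳ-expm1² a≢0 b≢0 (begin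
    (Fa *ₛ Fb) *ₛ (Ea *ₛ Eb)
      ≈⟨ solve 4 (λ Fa Fb Ea Eb → (Fa :* Fb) :* (Ea :* Eb) := (Fa :* Ea) :* (Fb :* Eb))
                 (λ _ → refl) Fa Fb Ea Eb ⟩
    (Fa *ₛ Ea) *ₛ (Fb *ₛ Eb)      ≈⟨ *ₛ-cong (bernAt*expm1 a a≢0) (bernAt*expm1 b b≢0) ⟩
    tₛ *ₛ tₛ                      ≈⟨ *ₛ-cong ≋-refl (bernAt*expm1 s s≢0) ⟨
    tₛ *ₛ (Fs *ₛ expm1 s)         ≈⟨ solve 3 (λ T Fs Es → T :* (Fs :* Es) := Fs :* (T :* Es))
                                       (λ _ → refl) tₛ Fs (expm1 s) ⟩
    Fs *ₛ (tₛ *ₛ expm1 s)         ≈⟨ *ₛ-cong ≋-refl (bernAt-sum*expm1² a b a≢0 b≢0 a+b≡s) ⟨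
    Fs *ₛ (G *ₛ (Ea *ₛ Eb))       ≈⟨ solve 4 (λ Fs G Ea Eb → Fs :* (G :* (Ea :* Eb)) := (G :* Fs) :* (Ea :* Eb))
                                       (λ _ → refl) Fs G Ea Eb ⟩
    (G *ₛ Fs) *ₛ (Ea *ₛ Eb)       ∎)
    where
    open ≋-Reasoning
    Fa = bernAt a a≢0
    Fb = bernAt b b≢0
    Fs = bernAt s s≢0
    G = Fa +ₛ Fb +ₛ tₛ
    Ea = expm1 a
    Eb = expm1 b

  1^ℕn≡1 : ∀ n → 1ℚ ^ℕ n ≡ 1ℚ
  1^ℕn≡1 zero    = refl
  1^ℕn≡1 (suc n) = cong (1ℚ *_) (1^ℕn≡1 n)

  [-1]^ℕ[2n]≡1 : ∀ n → (- 1ℚ) ^ℕ (2 ℕ.* n) ≡ 1ℚ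
  [-1]^ℕ[2n]≡1 zero    = refl
  [-1]^ℕ[2n]≡1 (suc n) = trans (cong ((- 1ℚ) ^ℕ_) (ℕ.*-suc 2 n)) (cong (λ p → - 1ℚ * (- 1ℚ * p)) ([-1]^ℕ[2n]≡1 n))

  bernAt-one : ∀ 1≢0 → bernAt 1ℚ 1≢0 ≋ bf bernoulli
  bernAt-one 1≢0 zero    = ℚ.*-identityʳ (bf bernoulli 0)
  bernAt-one 1≢0 (suc n) = trans (cong (bf bernoulli (suc n) *_) (1^ℕn≡1 n)) (ℚ.*-identityʳ _)

  -- Coefficient n of F_1 + F_{-1} + t unfolds to b 1ⁿ⁻¹ + b (-1)ⁿ⁻¹ + 0, with n - 1 even.
  bernoulli-odd : ∀ m → bf bernoulli (suc (2 ℕ.* suc m)) ≡ 0ℚ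
  bernoulli-odd m = halve (bf bernoulli n) (begin
    b * 1ℚ + b * 1ℚ + 0ℚ                                    ≡⟨ cong₂ (λ p q → b * p + b * q + 0ℚ)
                                                                 (1^ℕn≡1 (2 ℕ.* suc m)) ([-1]^ℕ[2n]≡1 (suc m)) ⟨
    (bernAt 1ℚ (λ ()) +ₛ bernAt (- 1ℚ) (λ ()) +ₛ tₛ) n      ≡⟨ bernAt+bernAt 1ℚ (- 1ℚ) (λ ()) (λ ()) refl n ⟩
    0ℚ                                                      ∎)
    where
    open ≡-Reasoning
    n = suc (2 ℕ.* suc m)
    b = bf bernoulli n
    halve : ∀ y → y * 1ℚ + y * 1ℚ + 0ℚ ≡ 0ℚ → y ≡ 0ℚ
    halve y eq = trans (double y) (trans (cong ((+ 1 / 2) *_) eq) (ℚ.*-zeroʳ (+ 1 / 2)))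
      where
      double : ∀ y → y ≡ (+ 1 / 2) * (y * 1ℚ + y * 1ℚ + 0ℚ)
      double = solve-∀ ℚ-ring

  -- Ramanujan polynomials

  -- The series Σ B_{n,1} aⁿ⁻¹ tⁿ/n! of t e^{a t}/(e^{a t} - 1).
  bern₁At : (a : ℚ) → a ≢ 0ℚ → Series
  bern₁At a a≢0 n = bf bernoulli1 n * powPred a a≢0 n

  bernoulli1-gf : bf bernoulli1 ≋ bf bernoulli +ₛ tₛ
  bernoulli1-gf zero          = refl
  bernoulli1-gf (suc zero)    = refl
  bernoulli1-gf (suc (suc n)) = sym (ℚ.+-identityʳ _)

  bern₁At≋bernAt+tₛ : ∀ a a≢0 → bern₁At a a≢0 ≋ bernAt a a≢0 +ₛ tₛ
  bern₁At≋bernAt+tₛ a a≢0 zero          = sym (ℚ.+-identityʳ _)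
  bern₁At≋bernAt+tₛ a a≢0 (suc zero)    = refl
  bern₁At≋bernAt+tₛ a a≢0 (suc (suc n)) = sym (ℚ.+-identityʳ _)

  ramanujan-coefficient : ∀ K x x≢0 → ramanujan K x x≢0 ≡ (bernAt x x≢0 *ₛ bf bernoulli) K
  ramanujan-coefficient K x x≢0 = begin
    ramanujan K x x≢0
      ≡⟨ cong sumℚ (List.map-upTo (λ s → bf bernoulli s * bf bernoulli (K ∸ s) * powPred x x≢0 s) (suc K)) ⟩
    sumℚ (applyUpTo (λ s → bf bernoulli s * bf bernoulli (K ∸ s) * powPred x x≢0 s) (suc K))
      ≡⟨ sumℚ-applyUpTo-cong (suc K) (λ {s} _ → swap (bf bernoulli s) (bf bernoulli (K ∸ s)) (powPred x x≢0 s)) ⟩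
    sumℚ (applyUpTo (λ s → bernAt x x≢0 s * bf bernoulli (K ∸ s)) (suc K))
      ≡⟨ *ₛ-as-sum (bernAt x x≢0) (bf bernoulli) K ⟨
    (bernAt x x≢0 *ₛ bf bernoulli) K ∎
    where
    open ≡-Reasoning
    swap : ∀ a b p → a * b * p ≡ a * p * b
    swap = solve-∀ ℚ-ring

  ramanujanGen-coefficient : ∀ K x x≢0 x≢1 → ramanujanGen K x x≢0 x≢1 ≡
    ((bf bernoulli1 -ₛ bern₁At x x≢0) *ₛ bern₁At (x - 1ℚ) x≢1) K
  ramanujanGen-coefficient K x x≢0 x≢1 = begin
    ramanujanGen K x x≢0 x≢1
      ≡⟨ cong sumℚ (List.map-upTo term (suc K)) ⟩
    sumℚ (applyUpTo term (suc K))
      ≡⟨ sumℚ-applyUpTo-cong (suc K) (λ s<1+K → term≡ (ℕ.≤-pred s<1+K)) ⟩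
    sumℚ (applyUpTo (λ s → (bf bernoulli1 -ₛ bern₁At x x≢0) s * bern₁At (x - 1ℚ) x≢1 (K ∸ s)) (suc K))
      ≡⟨ *ₛ-as-sum (bf bernoulli1 -ₛ bern₁At x x≢0) (bern₁At (x - 1ℚ) x≢1) K ⟨
    ((bf bernoulli1 -ₛ bern₁At x x≢0) *ₛ bern₁At (x - 1ℚ) x≢1) K ∎
    where
    open ≡-Reasoning
    term : ℕ → ℚ
    term s = bf bernoulli1 s * bf bernoulli1 (K ∸ s)
           * powℤ (x - 1ℚ) x≢1 ((+ K) ℤ.- (+ s) ℤ.- (+ 1))
           * (1ℚ - powℤ x x≢0 ((+ s) ℤ.- (+ 1)))
    regroup : ∀ a b l p → a * b * l * (1ℚ - p) ≡ (a + - (a * p)) * (b * l)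
    regroup = solve-∀ ℚ-ring
    term≡ : ∀ {s} → s ≤ K → term s ≡ (bf bernoulli1 -ₛ bern₁At x x≢0) s * bern₁At (x - 1ℚ) x≢1 (K ∸ s)
    term≡ {s} s≤K = trans
      (cong (λ e → bf bernoulli1 s * bf bernoulli1 (K ∸ s) * powℤ (x - 1ℚ) x≢1 (e ℤ.- (+ 1))
                     * (1ℚ - powPred x x≢0 s))
            (trans (ℤ.m-n≡m⊖n K s) (ℤ.⊖-≥ s≤K)))
      (regroup (bf bernoulli1 s) (bf bernoulli1 (K ∸ s)) (powPred (x - 1ℚ) x≢1 (K ∸ s)) (powPred x x≢0 s))

  ramanujanGen-gf : ∀ x (x≢0 : x ≢ 0ℚ) (x≢1 : x - 1ℚ ≢ 0ℚ) →
    (bf bernoulli1 -ₛ bern₁At x x≢0) *ₛ bern₁At (x - 1ℚ) x≢1 ≋ bernAt x x≢0 *ₛ bf bernoulli +ₛ tₛ *ₛ bf bernoulli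
  ramanujanGen-gf x x≢0 x≢1 = begin
    (bf bernoulli1 -ₛ bern₁At x x≢0) *ₛ bern₁At c x≢1
      ≈⟨ *ₛ-cong (+ₛ-cong bernoulli1-gf (-ₛ-cong (bern₁At≋bernAt+tₛ x x≢0))) (bern₁At≋bernAt+tₛ c x≢1) ⟩
    (B +ₛ tₛ -ₛ (Fx +ₛ tₛ)) *ₛ (Fc +ₛ tₛ)
      ≈⟨ solve 4 (λ B T Fx Fc → (B :+ T :- (Fx :+ T)) :* (Fc :+ T) := B :* Fc :- Fx :* Fc :+ (B :- Fx) :* T)
                 (λ _ → refl) B tₛ Fx Fc ⟩
    B *ₛ Fc -ₛ Fx *ₛ Fc +ₛ (B -ₛ Fx) *ₛ tₛ
      ≈⟨ +ₛ-cong (+ₛ-cong (*ₛ-cong (bernAt-one one≢0) ≋-refl) ≋-refl) ≋-refl ⟨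
    F₁ *ₛ Fc -ₛ Fx *ₛ Fc +ₛ (B -ₛ Fx) *ₛ tₛ
      ≈⟨ +ₛ-cong (+ₛ-cong (bernAt*bernAt 1ℚ c one≢0 x≢1 x≢0 (one+[x-one] x)) ≋-refl) ≋-refl ⟩
    (F₁ +ₛ Fc +ₛ tₛ) *ₛ Fx -ₛ Fx *ₛ Fc +ₛ (B -ₛ Fx) *ₛ tₛ
      ≈⟨ +ₛ-cong (+ₛ-cong (*ₛ-cong (+ₛ-cong (+ₛ-cong (bernAt-one one≢0) ≋-refl) ≋-refl) ≋-refl) ≋-refl) ≋-refl ⟩
    (B +ₛ Fc +ₛ tₛ) *ₛ Fx -ₛ Fx *ₛ Fc +ₛ (B -ₛ Fx) *ₛ tₛ
      ≈⟨ solve 4 (λ B T Fx Fc → (B :+ Fc :+ T) :* Fx :- Fx :* Fc :+ (B :- Fx) :* T := Fx :* B :+ T :* B)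
                 (λ _ → refl) B tₛ Fx Fc ⟩
    Fx *ₛ B +ₛ tₛ *ₛ B ∎
    where
    open ≋-Reasoning
    c = x - 1ℚ
    B = bf bernoulli
    one≢0 : 1ℚ ≢ 0ℚ
    one≢0 ()
    F₁ = bernAt 1ℚ one≢0
    Fx = bernAt x x≢0
    Fc = bernAt c x≢1
    one+[x-one] : ∀ x → 1ℚ + (x - 1ℚ) ≡ x
    one+[x-one] = solve-∀ ℚ-ring

  ramanujanGen≡ramanujan+ : ∀ K x (x≢0 : x ≢ 0ℚ) (x≢1 : x - 1ℚ ≢ 0ℚ) →
    ramanujanGen K x x≢0 x≢1 ≡ ramanujan K x x≢0 + (tₛ *ₛ bf bernoulli) K
  ramanujanGen≡ramanujan+ K x x≢0 x≢1 = begin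
    ramanujanGen K x x≢0 x≢1
      ≡⟨ ramanujanGen-coefficient K x x≢0 x≢1 ⟩
    ((bf bernoulli1 -ₛ bern₁At x x≢0) *ₛ bern₁At (x - 1ℚ) x≢1) K
      ≡⟨ ramanujanGen-gf x x≢0 x≢1 K ⟩
    (bernAt x x≢0 *ₛ bf bernoulli) K + (tₛ *ₛ bf bernoulli) K
      ≡⟨ cong (_+ (tₛ *ₛ bf bernoulli) K) (ramanujan-coefficient K x x≢0) ⟨
    ramanujan K x x≢0 + (tₛ *ₛ bf bernoulli) K ∎
    where open ≡-Reasoning

open RamanujanPolynomials using (ramanujanGen≡ramanujan+; tₛ; _*ₛ_; tₛ*ₛ-suc; bernoulli-odd)
open import Data.Nat using (ℕ; zero; suc; _<_; _*_; s≤s)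
open import Data.Nat.Properties using (*-suc)
open import Data.Rational using (ℚ; 0ℚ; 1ℚ; _-_; _+_)
open import Data.Rational.Properties using (+-identityʳ)
open import Relation.Binary.PropositionalEquality using (_≡_; _≢_; cong; trans; module ≡-Reasoning)
open import Defs

proposition3 : (k : ℕ) → 1 < k → (x : ℚ) → (x≢0 : x ≢ 0ℚ) → (x≢1 : x - 1ℚ ≢ 0ℚ) →
    ramanujanGen (2 * k) x x≢0 x≢1 ≡ ramanujan (2 * k) x x≢0
proposition3 (suc zero) (s≤s ())
proposition3 (suc (suc m)) _ x x≢0 x≢1 = begin
  ramanujanGen (2 * k) x x≢0 x≢1                            ≡⟨ ramanujanGen≡ramanujan+ (2 * k) x x≢0 x≢1 ⟩
  ramanujan (2 * k) x x≢0 + (tₛ *ₛ bf bernoulli) (2 * k)     ≡⟨ cong (ramanujan (2 * k) x x≢0 +_) odd-term ⟩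
  ramanujan (2 * k) x x≢0 + 0ℚ                               ≡⟨ +-identityʳ _ ⟩
  ramanujan (2 * k) x x≢0                                    ∎
  where
  open ≡-Reasoning
  k = suc (suc m)
  odd-term : (tₛ *ₛ bf bernoulli) (2 * k) ≡ 0ℚ
  odd-term = trans (cong (tₛ *ₛ bf bernoulli) (*-suc 2 (suc m)))
    (trans (tₛ*ₛ-suc (bf bernoulli) (suc (2 * suc m))) (bernoulli-odd m))
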